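{- Let $H=T\cup C$ be a Halin graph and run the procedure $\mathrm{DLIST}(H)$ described in the context. Then every spanning tree of $H$ is output by $\mathrm{DLIST}(H)$ at least once.
   Context: A Halin graph $H=T\cup C$ is obtained from a tree $T$ (the characteristic tree) that has no vertex of degree two and at least three leaves, by adding a cycle $C$ (the accompanying cycle) through all leaves of $T$, in the cyclic order of a plane embedding. Fix such an embedding, write $V(C)=\{v_1,\ldots,v_p\}$ with $e_i=v_iv_{i+1}$ for $1\le i\le p-1$ and $e_p=v_pv_1$, and root $T$ at a vertex $u$. For a spanning tree $T'$ of $H$ and an index $i$ with $e_i\notin E(T')$, let $C^*$ be the unique cycle of $T'+e_i$; let $P_{uv_i},P_{uv_{i+1}}$ be the paths in $T'$ from $u$, and let $v$ be the vertex of $P_{uv_i}\cap P_{uv_{i+1}}$ such that the subpaths $P_{vv_i}$ and $P_{vv_{i+1}}$ share only $v$ (so $C^*=P_{vv_i}\cup P_{vv_{i+1}}+e_i$). Put $E^R=E(P_{vv_{i+1}})$, and for an edge $f=xw\in E^R$ with $x$ lying on the subpath from $w$ to $v_{i+1}$, put $E^f=E(P_{xv_{i+1}})$ (edges of $P_{vv_{i+1}}$ between $x$ and $v_{i+1}$). Procedure $\mathrm{DREC}(T',B,i)$, where $B$ is a set of edges called blue: let $G^*=T'+e_i$; for each edge $b\in E(C^*)\setminus(E(C)\cup B)$: let $T^*=G^*-b$; if $b\notin E^R$ set $B^*=B\cup E^R$, otherwise set $B^*=B\cup E^b$; output $T^*$; then for every $j=i+1,\ldots,p$ call $\mathrm{DREC}(T^*,B^*,j)$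 (each call has its own copy of the blue set). Procedure $\mathrm{DLIST}(H)$: output $T$, then for every $i=1,\ldots,p$ call $\mathrm{DREC}(T,\emptyset,i)$. (The paper executes the branches in parallel on a CRCW PRAM, each new call on a new processor with coloring kept local; the set of outputs is the same.) -}

module Defs where

open import Data.Nat using (ℕ; zero; suc; _<_; _≤_)
open import Data.Nat.Properties using (_<?_)
open import Data.Fin using (Fin; toℕ; fromℕ<) renaming (zero to fzero; suc to fsuc)
open import Data.List using (List; []; _∷_; _++_; head; last)
open import Data.List.Membership.Propositional using (_∈_; _∉_)
open import Data.List.Relation.Unary.Linked using (Linked)
open import Data.List.Relation.Unary.Unique.Propositional using (Unique)
open import Data.Maybe using (just)
open import Data.Product using (_×_; _,_; Σ; ∃; ∃-syntax)
open import Data.Sum using (_⊎_)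
open import Data.Empty using (⊥)
open import Relation.Nullary using (¬_; yes; no)
open import Relation.Binary.PropositionalEquality using (_≡_; _≢_)
open import Function.Definitions using (Injective)

-- Graphs on the vertex set Fin n.  An edge set is a relation; the edge
-- {x,y} is present iff  S x y  (edge sets of graphs are required to be
-- symmetric where relevant).

EdgeRel : ℕ → Set₁
EdgeRel n = Fin n → Fin n → Set

Edge : ℕ → Set
Edge n = Fin n × Fin n

module _ {n : ℕ} where

  Symmetric : EdgeRel n → Set
  Symmetric S = ∀ x y → S x y → S y x

  Irreflexive : EdgeRel n → Set
  Irreflexive S = ∀ x → ¬ S x x

  SameEdge : Edge n → Fin n → Fin n → Set
  SameEdge (a , b) x y = (x ≡ a × y ≡ b) ⊎ (x ≡ b × y ≡ a)

  addE : EdgeRel n → Edge n → EdgeRel n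
  addE S e x y = S x y ⊎ SameEdge e x y

  delE : EdgeRel n → Edge n → EdgeRel n
  delE S e x y = S x y × ¬ SameEdge e x y

  _≐_ : EdgeRel n → EdgeRel n → Set
  S ≐ S' = ∀ x y → (S x y → S' x y) × (S' x y → S x y)

  _∈E_ : Edge n → List (Edge n) → Set
  (a , b) ∈E l = ((a , b) ∈ l) ⊎ ((b , a) ∈ l)

  _∉E_ : Edge n → List (Edge n) → Set
  e ∉E l = ¬ (e ∈E l)

  pathEdges : List (Fin n) → List (Edge n)
  pathEdges []           = []
  pathEdges (x ∷ [])     = []
  pathEdges (x ∷ y ∷ ps) = (x , y) ∷ pathEdges (y ∷ ps)

  record IsPath (S : EdgeRel n) (x y : Fin n) (ps : List (Fin n)) : Set where
    field
      starts : head ps ≡ just x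
      ends   : last ps ≡ just y
      adj    : Linked S ps
      uniq   : Unique ps

  record IsCycle (S : EdgeRel n) (ps : List (Fin n)) : Set where
    field
      x₀ x₁ x₂ : Fin n
      rest     : List (Fin n)
      shape    : ps ≡ x₀ ∷ x₁ ∷ x₂ ∷ rest
      adj      : Linked S ps
      closes   : ∀ z → last ps ≡ just z → S z x₀
      uniq     : Unique ps

  Connected : EdgeRel n → Set
  Connected S = ∀ x y → ∃[ ps ] IsPath S x y ps

  Acyclic : EdgeRel n → Set
  Acyclic S = ¬ (∃[ ps ] IsCycle S ps)

  -- a tree on the vertex set Fin n (so: spanning)
  IsTree : EdgeRel n → Set
  IsTree S = Symmetric S × Irreflexive S × Connected S × Acyclic S

  IsLeaf : EdgeRel n → Fin n → Set
  IsLeaf S x = ∃[ z ] (S x z × (∀ w → S x w → w ≡ z))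

  HasDegreeTwo : EdgeRel n → Fin n → Set
  HasDegreeTwo S x = ∃[ z ] ∃[ w ] (z ≢ w × S x z × S x w × (∀ y → S x y → y ≡ z ⊎ y ≡ w))

-- cyclic successor on indices of the accompanying cycle
-- (index k : Fin p stands for v_{k+1}; next k for v_{k+2}, cyclically)

next : {p : ℕ} → Fin p → Fin p
next {suc q} k with suc (toℕ k) <? suc q
... | yes lt = fromℕ< lt
... | no _   = fzero

iterN : {A : Set} → (A → A) → ℕ → A → A
iterN f zero    a = a
iterN f (suc t) a = f (iterN f t a)

CyclicInterval : {p : ℕ} → (Fin p → Set) → Set
CyclicInterval {p} P = ∃[ s ] ∃[ m ] (∀ k → (P k → ∃[ t ] (t < m × k ≡ iterN next t s))
                                          × (∃[ t ] (t < m × k ≡ iterN next t s) → P k))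

-- Halin graphs H = T ∪ C with a fixed plane embedding, represented by the
-- labelling v_1,...,v_p of the leaves of T in the cyclic order of the
-- embedding.  The cyclic orders of leaves arising from plane embeddings of
-- T are exactly those in which, for every edge ab of T, the leaves on the
-- a-side of ab form a cyclic interval.

record Halin (n : ℕ) : Set₁ where
  field
    T       : EdgeRel n
    T-tree  : IsTree T
    no-deg2 : ∀ x → ¬ HasDegreeTwo T x
    p       : ℕ
    3≤p     : 3 ≤ p
    v       : Fin p → Fin n
    v-inj   : Injective _≡_ _≡_ v
    v-leaf  : ∀ k → IsLeaf T (v k)
    leaf-v  : ∀ x → IsLeaf T x → ∃[ k ] v k ≡ x
    planar  : ∀ a b → T a b →
              CyclicInterval (λ k → ∃[ ps ] (IsPath T a (v k) ps × b ∉ ps))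

  e : Fin p → Edge n
  e k = v k , v (next k)

  CEdge : EdgeRel n
  CEdge x y = ∃[ k ] SameEdge (e k) x y

  HAdj : EdgeRel n
  HAdj x y = T x y ⊎ CEdge x y

  SpanningTree : EdgeRel n → Set
  SpanningTree S = (∀ x y → S x y → HAdj x y) × IsTree S

-- The procedure DLIST / DREC, rooted at u, described by which calls
-- DREC(T', B, i) occur and which trees are output.

module Procedure {n : ℕ} (H : Halin n) (u : Fin n) where
  open Halin H

  -- In the tree T' (= S), for the index i:  P_{u v_i} = pre ++ (w ∷ ra),
  -- P_{u v_{i+1}} = pre ++ (w ∷ rb) with ra, rb disjoint, so w is the
  -- vertex v of the paper, L = w ∷ ra is P_{v v_i} and R = w ∷ rb is
  -- P_{v v_{i+1}}.
  record CycleSplit (S : EdgeRel n) (i : Fin p) (L R : List (Fin n)) : Set where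
    field
      pre    : List (Fin n)
      w      : Fin n
      ra rb  : List (Fin n)
      pathA  : IsPath S u (v i) (pre ++ (w ∷ ra))
      pathB  : IsPath S u (v (next i)) (pre ++ (w ∷ rb))
      disj   : ∀ x → x ∈ ra → x ∈ rb → ⊥
      L-def  : L ≡ w ∷ ra
      R-def  : R ≡ w ∷ rb

  -- One iteration of the loop of DREC(S, B, i): choosing the edge b and
  -- producing the output T* and the new blue set B*.
  data Step (S : EdgeRel n) (B : List (Edge n)) (i : Fin p)
            : EdgeRel n → List (Edge n) → Set where
    -- b ∉ E^R :  B* = B ∪ E^R
    notInR : ∀ {L R} (b : Edge n) →
             ¬ S (v i) (v (next i)) →
             CycleSplit S i L R →
             b ∈E (pathEdges L ++ pathEdges R) →      -- b ∈ E(C*) \ {e_i}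
             ¬ CEdge (Data.Product.proj₁ b) (Data.Product.proj₂ b) →
             b ∉E B →
             b ∉E pathEdges R →
             Step S B i (delE (addE S (e i)) b) (B ++ pathEdges R)
    -- b = xw ∈ E^R, with x between w and v_{i+1}:  B* = B ∪ E^b
    inR    : ∀ {L R} (b : Edge n) →
             ¬ S (v i) (v (next i)) →
             CycleSplit S i L R →
             ¬ CEdge (Data.Product.proj₁ b) (Data.Product.proj₂ b) →
             b ∉E B →
             (pre : List (Fin n)) (w x : Fin n) (post : List (Fin n)) →
             R ≡ pre ++ (w ∷ x ∷ post) →
             SameEdge b w x →
             Step S B i (delE (addE S (e i)) b) (B ++ pathEdges (x ∷ post))

  -- Call S B i : the call DREC(S, B, i) is made during DLIST(H)
  data Call : EdgeRel n → List (Edge n) → Fin p → Set₁ where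
    start : ∀ i → Call T [] i
    recur : ∀ {S B i S* B*} → Call S B i → Step S B i S* B* →
            ∀ j → toℕ i < toℕ j → Call S* B* j

  data Output : EdgeRel n → Set₁ where
    out-T    : Output T
    out-step : ∀ {S B i S* B*} → Call S B i → Step S B i S* B* → Output S*

-- The run of DLIST(H) producing a given spanning tree S is found greedily along the
-- accompanying cycle.  Once the indices below k are handled, the current output X is a
-- spanning tree that contains E(S) ∩ E(T) and every e_j ∈ E(S) with j < k, whose remaining
-- edges lie in T, whose blue edges lie in S, and for which DREC(X, B, j) is called for all
-- j ≥ k.  If e_k ∈ E(S), then e_k ∉ E(X) and the cycle C* of X + e_k cannot lie inside the
-- tree S, so it has an edge b ∉ E(S); such an edge is neither a cycle edge nor blue, and
-- deleting it keeps a spanning tree.  Choosing b as the last edge outside S on the path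
-- towards v_{k+1} (or any edge outside S on the other path when that one lies in S) makes
-- the newly blue edges E^b (resp. E^R) edges of S.  After all p indices S ⊆ X, and a forest
-- containing a spanning tree is that tree.

module Submission where

open import Defs
open import Data.Empty using (⊥; ⊥-elim)
open import Data.Fin using (Fin; toℕ; fromℕ<; _≟_)
open import Data.Fin.Properties using (toℕ-fromℕ<; toℕ-injective; toℕ<n)
open import Data.List using (List; []; _∷_; _++_; head; last)
open import Data.List.Membership.Propositional using (_∈_; _∉_)
open import Data.List.Membership.Propositional.Properties using (∈-++⁺ˡ)
open import Data.List.Relation.Unary.All as All using (All; []; _∷_; lookup)
open import Data.List.Relation.Unary.All.Properties
  using (All¬⇒¬Any; ¬Any⇒All¬) renaming (++⁺ to All-++⁺)
open import Data.List.Relation.Unary.AllPairs using ([]; _∷_)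
open import Data.List.Relation.Unary.Any using (here; there)
open import Data.List.Relation.Unary.Linked as Linked using (Linked; [-]; _∷_)
open import Data.List.Relation.Unary.Unique.Propositional using (Unique)
open import Data.Maybe using (just)
open import Data.Maybe.Properties using (just-injective)
open import Data.Nat using (ℕ; zero; suc; _<_; _≤_; s≤s)
open import Data.Nat.Properties
  using ( _<?_; ≤-refl; ≤-reflexive; ≤-trans; ≤-antisym; ≮⇒≥; ≤⇒≯; n≤1+n; <⇒≤
        ; <-irrefl; <-≤-trans; m<n⇒m<1+n; m<1+n⇒m<n∨m≡n; 1+n≢n; m+1+n≢n)
open import Data.Product as Product
  using (Σ; ∃-syntax; _×_; _,_; proj₁; proj₂; map₁; map₂; uncurry′)
open import Data.Sum as Sum using (_⊎_; inj₁; inj₂)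
open import Data.Unit using (⊤; tt)
open import Function using (_∘_)
open import Relation.Binary.Construct.Closure.ReflexiveTransitive as Star
  using (Star; ε; _◅_; _◅◅_; _>>=_)
open import Relation.Nullary using (¬_; Dec; yes; no)
open import Relation.Nullary.Decidable using (_×-dec_; _⊎-dec_)
open import Relation.Binary.PropositionalEquality using (_≡_; _≢_; refl; sym; trans; cong; subst)

module _ {n : ℕ} where

  open import Data.List.Membership.DecPropositional (_≟_ {n}) using (_∈?_)

  SameEdge? : (e : Edge n) → ∀ s t → Dec (SameEdge e s t)
  SameEdge? (a , b) s t = (s ≟ a ×-dec t ≟ b) ⊎-dec (s ≟ b ×-dec t ≟ a)

  SameEdge-comm : ∀ {a b s t : Fin n} → SameEdge (a , b) s t → SameEdge (a , b) t s
  SameEdge-comm (inj₁ (s≡a , t≡b)) = inj₂ (t≡b , s≡a)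
  SameEdge-comm (inj₂ (s≡b , t≡a)) = inj₁ (t≡a , s≡b)

  SameEdge-sym : ∀ {a b s t : Fin n} → SameEdge (a , b) s t → SameEdge (s , t) a b
  SameEdge-sym (inj₁ (refl , refl)) = inj₁ (refl , refl)
  SameEdge-sym (inj₂ (refl , refl)) = inj₂ (refl , refl)

  resp-SameEdge : ∀ {R : EdgeRel n} → Symmetric R →
                  ∀ {a b s t} → SameEdge (a , b) s t → R s t → R a b
  resp-SameEdge sym-R (inj₁ (refl , refl)) r = r
  resp-SameEdge sym-R (inj₂ (refl , refl)) r = sym-R _ _ r

  symmetric-addE : ∀ {R : EdgeRel n} {a b} → Symmetric R → Symmetric (addE R (a , b))
  symmetric-addE sym-R x y = Sum.map (sym-R x y) SameEdge-comm

  symmetric-delE : ∀ {R : EdgeRel n} {a b} → Symmetric R → Symmetric (delE R (a , b))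
  symmetric-delE sym-R x y (r , ¬ab) = sym-R x y r , ¬ab ∘ SameEdge-comm

  rev : ∀ {R : EdgeRel n} → Symmetric R → ∀ {x y} → Star R x y → Star R y x
  rev sym-R = Star.reverse (sym-R _ _)

  -- Walks and paths

  module _ {R : EdgeRel n} where

    tailVerts : ∀ {x y} → Star R x y → List (Fin n)
    tailVerts ε = []
    tailVerts (_◅_ {j = y} _ W) = y ∷ tailVerts W

    verts : ∀ {x y} → Star R x y → List (Fin n)
    verts {x} W = x ∷ tailVerts W

    initVerts : ∀ {x y} → Star R x y → List (Fin n)
    initVerts ε = []
    initVerts (_◅_ {i = x} _ W) = x ∷ initVerts W

    verts-◅◅ : ∀ {x y z} (W₁ : Star R x y) (W₂ : Star R y z) →
               verts (W₁ ◅◅ W₂) ≡ initVerts W₁ ++ verts W₂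
    verts-◅◅ ε        W₂ = refl
    verts-◅◅ (r ◅ W₁) W₂ = cong (_ ∷_) (verts-◅◅ W₁ W₂)

    ∈-◅◅ˡ : ∀ {a x y z} (W₁ : Star R x y) (W₂ : Star R y z) →
            a ∈ verts W₁ → a ∈ verts (W₁ ◅◅ W₂)
    ∈-◅◅ˡ ε        W₂ (here refl) = here refl
    ∈-◅◅ˡ (r ◅ W₁) W₂ (here refl) = here refl
    ∈-◅◅ˡ (r ◅ W₁) W₂ (there a∈)  = there (∈-◅◅ˡ W₁ W₂ a∈)

    ∈-◅◅ʳ : ∀ {a x y z} (W₁ : Star R x y) (W₂ : Star R y z) →
            a ∈ verts W₂ → a ∈ verts (W₁ ◅◅ W₂)
    ∈-◅◅ʳ ε        W₂ a∈ = a∈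
    ∈-◅◅ʳ (r ◅ W₁) W₂ a∈ = there (∈-◅◅ʳ W₁ W₂ a∈)

    ∈-◅◅⁻ : ∀ {a x y z} (W₁ : Star R x y) (W₂ : Star R y z) →
            a ∈ verts (W₁ ◅◅ W₂) → a ∈ verts W₁ ⊎ a ∈ tailVerts W₂
    ∈-◅◅⁻ ε        W₂ (here a≡y) = inj₁ (here a≡y)
    ∈-◅◅⁻ ε        W₂ (there a∈) = inj₂ a∈
    ∈-◅◅⁻ (r ◅ W₁) W₂ (here a≡x) = inj₁ (here a≡x)
    ∈-◅◅⁻ (r ◅ W₁) W₂ (there a∈) = Sum.map₁ there (∈-◅◅⁻ W₁ W₂ a∈)

    target∈verts : ∀ {x y} (W : Star R x y) → y ∈ verts W
    target∈verts ε       = here refl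
    target∈verts (r ◅ W) = there (target∈verts W)

    target∈tailVerts : ∀ {x c d y} (W₁ : Star R x c) (r : R c d) (W₂ : Star R d y) →
                       d ∈ tailVerts (W₁ ◅◅ (r ◅ W₂))
    target∈tailVerts ε        r W₂ = here refl
    target∈tailVerts (s ◅ W₁) r W₂ = there (target∈tailVerts W₁ r W₂)

    Unique-◅◅ˡ : ∀ {x y z} (W₁ : Star R x y) (W₂ : Star R y z) →
                 Unique (verts (W₁ ◅◅ W₂)) → Unique (verts W₁)
    Unique-◅◅ˡ ε        W₂ _          = [] ∷ []
    Unique-◅◅ˡ (r ◅ W₁) W₂ (x≢ ∷ uW) =
      ¬Any⇒All¬ _ (All¬⇒¬Any x≢ ∘ ∈-◅◅ˡ W₁ W₂) ∷ Unique-◅◅ˡ W₁ W₂ uW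

    Unique-◅◅ʳ : ∀ {x y z} (W₁ : Star R x y) (W₂ : Star R y z) →
                 Unique (verts (W₁ ◅◅ W₂)) → Unique (verts W₂)
    Unique-◅◅ʳ ε        W₂ uW       = uW
    Unique-◅◅ʳ (r ◅ W₁) W₂ (_ ∷ uW) = Unique-◅◅ʳ W₁ W₂ uW

    Unique-◅◅⁺ : ∀ {x y z} (W₁ : Star R x y) (W₂ : Star R y z) →
                 Unique (verts W₁) → Unique (verts W₂) →
                 (∀ {a} → a ∈ verts W₁ → a ∉ tailVerts W₂) →
                 Unique (verts (W₁ ◅◅ W₂))
    Unique-◅◅⁺ ε        W₂ _          u₂ _       = u₂
    Unique-◅◅⁺ (r ◅ W₁) W₂ (x≢ ∷ u₁) u₂ disjoint =
      ¬Any⇒All¬ _ (Sum.[ All¬⇒¬Any x≢ , disjoint (here refl) ]′ ∘ ∈-◅◅⁻ W₁ W₂)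
      ∷ Unique-◅◅⁺ W₁ W₂ u₁ u₂ (disjoint ∘ there)

    path-target∉prefix : ∀ {x c d y} (W₁ : Star R x c) (r : R c d) (W₂ : Star R d y) →
                         Unique (verts (W₁ ◅◅ (r ◅ W₂))) → d ∉ verts W₁
    path-target∉prefix ε        r W₂ (c≢ ∷ _) (here d≡c) = All.head c≢ (sym d≡c)
    path-target∉prefix (s ◅ W₁) r W₂ (x≢ ∷ _) (here d≡x) =
      All¬⇒¬Any x≢ (subst (_∈ _) d≡x (∈-◅◅ʳ W₁ (r ◅ W₂) (there (here refl))))
    path-target∉prefix (s ◅ W₁) r W₂ (_ ∷ uW) (there d∈) =
      path-target∉prefix W₁ r W₂ uW d∈

    linked : ∀ {x y} (W : Star R x y) → Linked R (verts W)
    linked ε        = [-]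
    linked (r ◅ W) = r ∷ linked W

    last-verts : ∀ {x y} (W : Star R x y) → last (verts W) ≡ just y
    last-verts ε        = refl
    last-verts (r ◅ W) = last-verts W

    Unique⇒IsPath : ∀ {x y} (W : Star R x y) → Unique (verts W) → IsPath R x y (verts W)
    Unique⇒IsPath W uW = record
      { starts = refl ; ends = last-verts W ; adj = linked W ; uniq = uW }

    walk-of : ∀ {x y} ps → head ps ≡ just x → last ps ≡ just y → Linked R ps →
              Σ (Star R x y) λ W → verts W ≡ ps
    walk-of (a ∷ [])     refl refl _ = ε , refl
    walk-of (a ∷ b ∷ ps) refl ends (r ∷ lk) with walk-of (b ∷ ps) refl ends lk
    ... | W , refl = r ◅ W , refl

    IsPath⇒Unique-walk : ∀ {x y ps} → IsPath R x y ps → Σ (Star R x y) (Unique ∘ verts)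
    IsPath⇒Unique-walk {ps = ps} P
      with walk-of ps (IsPath.starts P) (IsPath.ends P) (IsPath.adj P)
    ... | W , refl = W , IsPath.uniq P

    record Split {x y} (W : Star R x y) (m : Fin n) : Set where
      constructor split
      field
        front       : Star R x m
        back        : Star R m y
        front◅◅back : W ≡ front ◅◅ back

    splitAt : ∀ {a x y} (W : Star R x y) → a ∈ verts W → Split W a
    splitAt ε       (here refl) = split ε ε refl
    splitAt (r ◅ W) (here refl) = split ε (r ◅ W) refl
    splitAt (r ◅ W) (there a∈) with splitAt W a∈
    ... | split W₁ W₂ refl = split (r ◅ W₁) W₂ refl

    loop-erase : ∀ {x y} → Star R x y → Σ (Star R x y) (Unique ∘ verts)
    loop-erase ε = ε , [] ∷ []
    loop-erase (_◅_ {i = x} r W) with loop-erase W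
    ... | W′ , uW′ with x ∈? verts W′
    ...   | no x∉ = r ◅ W′ , ¬Any⇒All¬ _ x∉ ∷ uW′
    ...   | yes x∈ with splitAt W′ x∈
    ...     | split W₁ W₂ refl = W₂ , Unique-◅◅ʳ W₁ W₂ uW′

    last-satisfying : ∀ {P : Fin n → Set} → (∀ z → Dec (P z)) →
                      ∀ {x y} (W : Star R x y) →
                      All (¬_ ∘ P) (verts W) ⊎
                      ∃[ m ] (P m × Σ (Split W m) λ s → All (¬_ ∘ P) (tailVerts (Split.back s)))
    last-satisfying P? {x} ε with P? x
    ... | yes Px = inj₂ (x , Px , split ε ε refl , [])
    ... | no ¬Px = inj₁ (¬Px ∷ [])
    last-satisfying P? {x} (r ◅ W) with last-satisfying P? W
    ... | inj₂ (m , Pm , split W₁ W₂ refl , later) =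
      inj₂ (m , Pm , split (r ◅ W₁) W₂ refl , later)
    ... | inj₁ none with P? x
    ...   | yes Px = inj₂ (x , Px , split ε (r ◅ W) refl , none)
    ...   | no ¬Px = inj₁ (¬Px ∷ none)

    AllEdges : EdgeRel n → ∀ {x y} → Star R x y → Set
    AllEdges P ε                       = ⊤
    AllEdges P (_◅_ {i = x} {j = y} _ W) = P x y × AllEdges P W

    AllEdges⇒pathEdges : ∀ {P x y} (W : Star R x y) → AllEdges P W →
                         All (uncurry′ P) (pathEdges (verts W))
    AllEdges⇒pathEdges ε        _           = []
    AllEdges⇒pathEdges (r ◅ W) (Pxy , PW) = Pxy ∷ AllEdges⇒pathEdges W PW

    restrict : ∀ {P Q : EdgeRel n} → (∀ {s t} → R s t → P s t → Q s t) →
               ∀ {x y} (W : Star R x y) → AllEdges P W → Star Q x y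
    restrict f ε        _           = ε
    restrict f (r ◅ W) (Pxy , PW) = f r Pxy ◅ restrict f W PW

    ∈-pathEdges : ∀ {x c d y} (W₁ : Star R x c) (r : R c d) (W₂ : Star R d y) →
                  (c , d) ∈ pathEdges (verts (W₁ ◅◅ (r ◅ W₂)))
    ∈-pathEdges ε        r W₂ = here refl
    ∈-pathEdges (s ◅ W₁) r W₂ = there (∈-pathEdges W₁ r W₂)

    record LastViolation (P : EdgeRel n) {x y} (W : Star R x y) : Set where
      field
        {c d}    : Fin n
        before   : Star R x c
        edge     : R c d
        after    : Star R d y
        splits   : W ≡ before ◅◅ (edge ◅ after)
        violates : ¬ P c d
        after-P  : AllEdges P after

    last-violation : ∀ {P : EdgeRel n} → (∀ s t → Dec (P s t)) →
                     ∀ {x y} (W : Star R x y) → AllEdges P W ⊎ LastViolation P W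
    last-violation P? ε = inj₁ tt
    last-violation P? (_◅_ {i = x} {j = z} r W) with last-violation P? W
    ... | inj₂ v = inj₂ (record
      { before = r ◅ before ; edge = edge ; after = after ; splits = cong (r ◅_) splits
      ; violates = violates ; after-P = after-P })
      where open LastViolation v
    ... | inj₁ W-P with P? x z
    ...   | yes Pxz = inj₁ (Pxz , W-P)
    ...   | no ¬Pxz = inj₂ (record
      { before = ε ; edge = r ; after = W ; splits = refl ; violates = ¬Pxz ; after-P = W-P })

    avoiding : ∀ {c d x y} (W : Star R x y) → d ∉ verts W → Star (delE R (c , d)) x y
    avoiding ε        _  = ε
    avoiding {c} {d} (_◅_ {i = x} {j = y} r W) d∉ = (r , endpoint) ◅ avoiding W (d∉ ∘ there)
      where
      endpoint : ¬ SameEdge (c , d) x y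
      endpoint (inj₁ (_ , refl)) = d∉ (there (here refl))
      endpoint (inj₂ (refl , _)) = d∉ (here refl)

    avoiding′ : ∀ {c d x y} (W : Star R x y) → c ∉ verts W → Star (delE R (c , d)) x y
    avoiding′ W c∉ = Star.map (map₂ (_∘ Sum.swap)) (avoiding W c∉)

    reroute : ∀ {R′ : EdgeRel n} {c d} → Symmetric R′ →
              (∀ {s t} → R s t → ¬ SameEdge (c , d) s t → R′ s t) →
              Star R′ c d → ∀ {x y} → Star R x y → Star R′ x y
    reroute {R′} {c} {d} sym-R′ keep c⇝d W = W >>= bridge
      where
      bridge : ∀ {s t} → R s t → Star R′ s t
      bridge {s} {t} r with SameEdge? (c , d) s t
      ... | yes (inj₁ (refl , refl)) = c⇝d
      ... | yes (inj₂ (refl , refl)) = rev sym-R′ c⇝d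
      ... | no ¬cd                   = keep r ¬cd ◅ ε

    record Fork {u a} (PA : Star R u a) (b : Fin n) : Set where
      field
        {branch}     : Fin n
        stem         : Star R u branch
        left         : Star R branch a
        right        : Star R branch b
        PA-splits    : PA ≡ stem ◅◅ left
        right-unique : Unique (verts right)
        right-fresh  : All (_∉ verts PA) (tailVerts right)

      stem⊆PA : ∀ {z} → z ∈ verts stem → z ∈ verts PA
      stem⊆PA = subst (λ W → _ ∈ verts W) (sym PA-splits) ∘ ∈-◅◅ˡ stem left

      left⊆PA : ∀ {z} → z ∈ verts left → z ∈ verts PA
      left⊆PA = subst (λ W → _ ∈ verts W) (sym PA-splits) ∘ ∈-◅◅ʳ stem left

      right-fresh-left : ∀ {z} → z ∈ tailVerts right → z ∉ verts left
      right-fresh-left z∈ = lookup right-fresh z∈ ∘ left⊆PA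

      tails-disjoint : ∀ z → z ∈ tailVerts left → z ∈ tailVerts right → ⊥
      tails-disjoint z z∈left z∈right = right-fresh-left z∈right (there z∈left)

      left-unique : Unique (verts PA) → Unique (verts left)
      left-unique uPA = Unique-◅◅ʳ stem left (subst (Unique ∘ verts) PA-splits uPA)

      stem◅◅right-unique : Unique (verts PA) → Unique (verts (stem ◅◅ right))
      stem◅◅right-unique uPA =
        Unique-◅◅⁺ stem right (Unique-◅◅ˡ stem left (subst (Unique ∘ verts) PA-splits uPA))
                   right-unique
                   (λ z∈stem z∈right → lookup right-fresh z∈right (stem⊆PA z∈stem))

    fork : ∀ {u a b} (PA : Star R u a) → Σ (Star R u b) (Unique ∘ verts) → Fork PA b
    fork PA (PB , uPB) with last-satisfying (_∈? verts PA) PB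
    ... | inj₁ (u∉PA ∷ _) = ⊥-elim (u∉PA (here refl))
    ... | inj₂ (_ , w∈PA , split PB₁ PB₂ PB-splits , fresh) with splitAt PA w∈PA
    ...   | split PA₁ PA₂ PA-splits = record
      { stem = PA₁ ; left = PA₂ ; right = PB₂ ; PA-splits = PA-splits
      ; right-unique = Unique-◅◅ʳ PB₁ PB₂ (subst (Unique ∘ verts) PB-splits uPB)
      ; right-fresh = fresh }

    leaf-neighbour-unique : ∀ {x a b} → IsLeaf R x → R x a → R x b → a ≡ b
    leaf-neighbour-unique (_ , _ , only) ra rb = trans (only _ ra) (sym (only _ rb))

    adjacent-leaves-isolated : ∀ {x y} → Symmetric R → IsLeaf R x → IsLeaf R y → R x y →
                               ∀ {z} (W : Star R x z) → Unique (verts W) → z ≡ x ⊎ z ≡ y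
    adjacent-leaves-isolated sym-R leaf-x leaf-y rxy ε _ = inj₁ refl
    adjacent-leaves-isolated sym-R leaf-x leaf-y rxy (r ◅ ε) _ =
      inj₂ (leaf-neighbour-unique leaf-x r rxy)
    adjacent-leaves-isolated {x} {y} sym-R leaf-x leaf-y rxy (r ◅ r′ ◅ W) (x≢ ∷ _)
      with leaf-neighbour-unique leaf-x r rxy
    ... | refl =
      ⊥-elim (All¬⇒¬Any x≢ (there (here (leaf-neighbour-unique leaf-y (sym-R x y rxy) r′))))

  -- Forests

  -- Every edge is a bridge: for symmetric irreflexive relations this is acyclicity, in a form
  -- that transports easily along edge insertions and deletions.
  Forest : EdgeRel n → Set
  Forest R = ∀ c d → R c d → ¬ Star (delE R (c , d)) c d

  Forest-⊆ : ∀ {R R′ : EdgeRel n} → (∀ {s t} → R′ s t → R s t) → Forest R → Forest R′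
  Forest-⊆ sub forest c d r W = forest c d (sub r) (Star.map (map₁ sub) W)

  delE-addE⊆addE-delE : ∀ {R : EdgeRel n} {e f s t} →
                        delE (addE R e) f s t → addE (delE R f) e s t
  delE-addE⊆addE-delE (inj₁ r , ¬f) = inj₁ (r , ¬f)
  delE-addE⊆addE-delE (inj₂ e , _)  = inj₂ e

  delE-addE-swap : ∀ {R : EdgeRel n} {a b f s t} →
                   delE (addE R (a , b)) f s t → delE (addE R (b , a)) f s t
  delE-addE-swap = map₁ (Sum.map₂ Sum.swap)

  walk-addE : ∀ {R : EdgeRel n} {p q} → Symmetric R → ∀ {x y} → Star (addE R (p , q)) x y →
              Star R x y ⊎ (Star R x p × Star R q y) ⊎ (Star R x q × Star R p y)
  walk-addE sym-R ε = inj₁ ε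
  walk-addE sym-R (inj₁ r ◅ W) with walk-addE sym-R W
  ... | inj₁ W′                = inj₁ (r ◅ W′)
  ... | inj₂ (inj₁ (W₁ , W₂)) = inj₂ (inj₁ (r ◅ W₁ , W₂))
  ... | inj₂ (inj₂ (W₁ , W₂)) = inj₂ (inj₂ (r ◅ W₁ , W₂))
  walk-addE sym-R (inj₂ (inj₁ (refl , refl)) ◅ W) with walk-addE sym-R W
  ... | inj₁ q⇝y                 = inj₂ (inj₁ (ε , q⇝y))
  ... | inj₂ (inj₁ (q⇝p , q⇝y)) = inj₁ (rev sym-R q⇝p ◅◅ q⇝y)
  ... | inj₂ (inj₂ (_ , p⇝y))   = inj₁ p⇝y
  walk-addE sym-R (inj₂ (inj₂ (refl , refl)) ◅ W) with walk-addE sym-R W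
  ... | inj₁ p⇝y                 = inj₂ (inj₂ (ε , p⇝y))
  ... | inj₂ (inj₁ (_ , q⇝y))   = inj₁ q⇝y
  ... | inj₂ (inj₂ (p⇝q , p⇝y)) = inj₁ (rev sym-R p⇝q ◅◅ p⇝y)

  acyclic⇒forest : ∀ {R : EdgeRel n} → Symmetric R → Irreflexive R → Acyclic R → Forest R
  acyclic⇒forest {R} sym-R irr acyc c d r W with loop-erase W
  ... | ε , _ = irr c r
  ... | (_ , ¬cd) ◅ ε , _ = ¬cd (inj₁ (refl , refl))
  ... | P@(_ ◅ _ ◅ P′) , uP = acyc (verts P , record
    { x₀ = c ; x₁ = _ ; x₂ = _ ; rest = tailVerts P′ ; shape = refl
    ; adj = Linked.map proj₁ (linked P)
    ; closes = λ z last≡z →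
        subst (λ t → R t c) (just-injective (trans (sym (last-verts P)) last≡z)) (sym-R c d r)
    ; uniq = uP })

  Forest-addE : ∀ {R : EdgeRel n} {p q} → Symmetric R → Forest R → ¬ Star R p q →
                Forest (addE R (p , q))
  Forest-addE {R} {p} {q} sym-R forest ¬p⇝q _ _ (inj₂ (inj₁ (refl , refl))) W =
    ¬p⇝q (Star.map drop-pq W)
    where
    drop-pq : ∀ {s t} → delE (addE R (p , q)) (p , q) s t → R s t
    drop-pq (inj₁ r , _)   = r
    drop-pq (inj₂ pq , ¬pq) = ⊥-elim (¬pq pq)
  Forest-addE {R} {p} {q} sym-R forest ¬p⇝q _ _ (inj₂ (inj₂ (refl , refl))) W =
    ¬p⇝q (rev sym-R (Star.map drop-qp W))
    where
    drop-qp : ∀ {s t} → delE (addE R (p , q)) (q , p) s t → R s t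
    drop-qp (inj₁ r , _)   = r
    drop-qp (inj₂ pq , ¬qp) = ⊥-elim (¬qp (Sum.swap pq))
  Forest-addE {R} sym-R forest ¬p⇝q g h (inj₁ r) W
    with walk-addE (symmetric-delE sym-R) (Star.map (delE-addE⊆addE-delE {R}) W)
  ... | inj₁ g⇝h = forest g h r g⇝h
  ... | inj₂ (inj₁ (g⇝p , q⇝h)) =
    ¬p⇝q (rev sym-R (Star.map proj₁ g⇝p) ◅◅ r ◅ rev sym-R (Star.map proj₁ q⇝h))
  ... | inj₂ (inj₂ (g⇝q , p⇝h)) =
    ¬p⇝q (Star.map proj₁ p⇝h ◅◅ sym-R g h r ◅ Star.map proj₁ g⇝q)

  exchange : ∀ {R : EdgeRel n} {c d p q} → Symmetric R → Forest R → R c d →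
             ¬ SameEdge (p , q) c d → Star (delE R (c , d)) c p → Star (delE R (c , d)) d q →
             Forest (delE (addE R (p , q)) (c , d)) × Star (delE (addE R (p , q)) (c , d)) c d
  exchange {R} {c} {d} {p} {q} sym-R forest r ¬pq c⇝p d⇝q =
    Forest-⊆ (delE-addE⊆addE-delE {R})
             (Forest-addE (symmetric-delE sym-R) (Forest-⊆ proj₁ forest) ¬p⇝q) ,
    Star.map (map₁ inj₁) c⇝p ◅◅ (inj₂ (inj₁ (refl , refl)) , ¬pq ∘ SameEdge-sym)
                             ◅ Star.map (map₁ inj₁) (rev (symmetric-delE sym-R) d⇝q)
    where
    ¬p⇝q : ¬ Star (delE R (c , d)) p q
    ¬p⇝q p⇝q = forest c d r (c⇝p ◅◅ p⇝q ◅◅ rev (symmetric-delE sym-R) d⇝q)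

  forest-adjacency? : ∀ {R : EdgeRel n} → Irreflexive R → Forest R →
                      (∀ x y → Σ (Star R x y) (Unique ∘ verts)) → ∀ x y → Dec (R x y)
  forest-adjacency? {R} irr forest path x y with path x y
  ... | ε , _ = no (irr x)
  ... | r ◅ ε , _ = yes r
  ... | r ◅ W@(_◅_ {i = y₁} _ W′) , (x≢ ∷ y₁≢ ∷ _) =
    no λ rxy → forest x y rxy ((r , first-edge) ◅ avoiding′ W (All¬⇒¬Any x≢))
    where
    first-edge : ¬ SameEdge (x , y) x y₁
    first-edge (inj₁ (_ , refl)) = All¬⇒¬Any y₁≢ (target∈verts W′)
    first-edge (inj₂ (refl , _)) = All¬⇒¬Any x≢ (target∈verts W)

  IsTree⇒Forest : ∀ {R : EdgeRel n} → IsTree R → Forest R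
  IsTree⇒Forest (sym-R , irr , _ , acyc) = acyclic⇒forest sym-R irr acyc

  IsTree⇒paths : ∀ {R : EdgeRel n} → IsTree R → ∀ x y → Σ (Star R x y) (Unique ∘ verts)
  IsTree⇒paths (_ , _ , connected , _) x y = IsPath⇒Unique-walk (proj₂ (connected x y))

  IsTree-adjacency? : ∀ {R : EdgeRel n} → IsTree R → ∀ x y → Dec (R x y)
  IsTree-adjacency? tree@(_ , irr , _ , _) =
    forest-adjacency? irr (IsTree⇒Forest tree) (IsTree⇒paths tree)

  tree⊆forest⇒≐ : ∀ {S X : EdgeRel n} → IsTree S → Forest X →
                  (∀ {x y} → S x y → X x y) → X ≐ S
  tree⊆forest⇒≐ {S} {X} S-tree@(sym-S , _) forest S⊆X x y = X⇒S , S⊆X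
    where
    X⇒S : X x y → S x y
    X⇒S xy with IsTree-adjacency? S-tree x y
    ... | yes s = s
    ... | no ¬s = ⊥-elim (forest x y xy (Star.map bypass (proj₁ (IsTree⇒paths S-tree x y))))
      where
      bypass : ∀ {s t} → S s t → delE X (x , y) s t
      bypass st = S⊆X st , λ xy≅st → ¬s (resp-SameEdge sym-S xy≅st st)

-- Cycle indices

<suc-split : ∀ {m k} {i j : Fin m} → toℕ i ≡ k → toℕ j < suc k → toℕ j < k ⊎ j ≡ i
<suc-split i≡k j<1+k =
  Sum.map₂ (λ j≡k → toℕ-injective (trans j≡k (sym i≡k))) (m<1+n⇒m<n∨m≡n j<1+k)

next-spec : ∀ {p} (k : Fin p) →
            toℕ (next k) ≡ suc (toℕ k) ⊎ (toℕ (next k) ≡ 0 × suc (toℕ k) ≡ p)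
next-spec {suc q} k with suc (toℕ k) <? suc q
... | yes k+1<p = inj₁ (toℕ-fromℕ< k+1<p)
... | no  k+1≮p = inj₂ (refl , ≤-antisym (toℕ<n k) (≮⇒≥ k+1≮p))

next-fixed⇒p≤1 : ∀ {p} (k : Fin p) → next k ≡ k → p ≤ 1
next-fixed⇒p≤1 k next≡k with next-spec k | cong toℕ next≡k
... | inj₁ s₁         | e = ⊥-elim (1+n≢n (trans (sym s₁) e))
... | inj₂ (z₁ , p₁) | e = ≤-reflexive (trans (sym p₁) (cong suc (trans (sym e) z₁)))

next²-fixed⇒p≤2 : ∀ {p} (k : Fin p) → next (next k) ≡ k → p ≤ 2
next²-fixed⇒p≤2 k next²≡k with next-spec k | next-spec (next k) | cong toℕ next²≡k
... | inj₁ s₁         | inj₁ s₂         | e =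
  ⊥-elim (m+1+n≢n 1 (trans (sym (trans s₂ (cong suc s₁))) e))
... | inj₁ s₁         | inj₂ (z₂ , p₂) | e =
  ≤-reflexive (trans (sym p₂) (cong suc (trans s₁ (cong suc (trans (sym e) z₂)))))
... | inj₂ (z₁ , p₁) | inj₁ s₂         | e =
  ≤-reflexive (trans (sym p₁) (cong suc (trans (sym e) (trans s₂ (cong suc z₁)))))
... | inj₂ (z₁ , _)  | inj₂ (_ , p₂)   | _ =
  ≤-trans (≤-reflexive (trans (sym p₂) (cong suc z₁))) (n≤1+n 1)

module Completeness {n : ℕ} (H : Halin n) (u : Fin n) {S : EdgeRel n}
                    (S-spanning : Halin.SpanningTree H S) where

  open Halin H
  open Procedure H u

  private
    variable
      k : ℕ
      x y : Fin n
      X : EdgeRel n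
      B : List (Edge n)

  symT : Symmetric T
  symT = proj₁ T-tree

  S-tree : IsTree S
  S-tree = proj₂ S-spanning

  symS : Symmetric S
  symS = proj₁ S-tree

  S? : ∀ x y → Dec (S x y)
  S? = IsTree-adjacency? S-tree

  p≰2 : ¬ p ≤ 2
  p≰2 = ≤⇒≯ 3≤p ∘ s≤s

  T-no-cycleEdge : ∀ j → ¬ T (v j) (v (next j))
  T-no-cycleEdge j t with IsTree⇒paths T-tree (v j) (v (next (next j)))
  ... | W , uW with adjacent-leaves-isolated symT (v-leaf j) (v-leaf (next j)) t W uW
  ... | inj₁ eq = p≰2 (next²-fixed⇒p≤2 j (v-inj eq))
  ... | inj₂ eq = p≰2 (≤-trans (next-fixed⇒p≤1 (next j) (v-inj eq)) (n≤1+n 1))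

  T⇒¬CEdge : T x y → ¬ CEdge x y
  T⇒¬CEdge t (j , inj₁ (refl , refl)) = T-no-cycleEdge j t
  T⇒¬CEdge t (j , inj₂ (refl , refl)) = T-no-cycleEdge j (symT _ _ t)

  cycleEdge-injective : ∀ {i j} → SameEdge (e j) (v i) (v (next i)) → j ≡ i
  cycleEdge-injective (inj₁ (vi≡vj , _))      = sym (v-inj vi≡vj)
  cycleEdge-injective (inj₂ (vi≡vj+1 , vi+1≡vj)) =
    ⊥-elim (p≰2 (next²-fixed⇒p≤2 _
                  (trans (cong next (sym (v-inj vi≡vj+1))) (v-inj vi+1≡vj))))

  EarlierCycleEdge : ℕ → EdgeRel n
  EarlierCycleEdge k x y = ∃[ j ] (toℕ j < k × SameEdge (e j) x y)

  earlier-suc : EarlierCycleEdge k x y → EarlierCycleEdge (suc k) x y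
  earlier-suc = map₂ (map₁ m<n⇒m<1+n)

  record Agrees (k : ℕ) (X : EdgeRel n) (B : List (Edge n)) : Set where
    field
      symmetric : Symmetric X
      forest    : Forest X
      reach     : ∀ z → Star X u z
      sound     : ∀ {x y} → X x y → T x y ⊎ (S x y × EarlierCycleEdge k x y)
      keeps-T   : ∀ {x y} → S x y → T x y → X x y
      keeps-C   : ∀ j → toℕ j < k → S (v j) (v (next j)) → X (v j) (v (next j))
      blue⊆S    : All (uncurry′ S) B

    cycleEdge∉ : ∀ {i} → k ≤ toℕ i → ¬ X (v i) (v (next i))
    cycleEdge∉ {i} k≤i x with sound x
    ... | inj₁ t                     = T-no-cycleEdge i t
    ... | inj₂ (_ , j , j<k , eⱼ≅eᵢ) =
      <-irrefl (cong toℕ (cycleEdge-injective eⱼ≅eᵢ)) (<-≤-trans j<k k≤i)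

    outside-S-removable : ∀ {c d} → X c d → ¬ S c d → ¬ CEdge c d × (c , d) ∉E B
    outside-S-removable {c} {d} xcd ¬Scd = ¬C , ¬B
      where
      ¬C : ¬ CEdge c d
      ¬C cycle with sound xcd
      ... | inj₁ t       = T⇒¬CEdge t cycle
      ... | inj₂ (s , _) = ¬Scd s
      ¬B : (c , d) ∉E B
      ¬B (inj₁ cd∈B) = ¬Scd (lookup blue⊆S cd∈B)
      ¬B (inj₂ dc∈B) = ¬Scd (symS _ _ (lookup blue⊆S dc∈B))

  Agrees-T : Agrees 0 T []
  Agrees-T = record
    { symmetric = symT ; forest = IsTree⇒Forest T-tree ; reach = proj₁ ∘ IsTree⇒paths T-tree u
    ; sound = inj₁ ; keeps-T = λ _ t → t ; keeps-C = λ _ () ; blue⊆S = [] }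

  Agrees-skip : ∀ {i} → Agrees k X B → toℕ i ≡ k → ¬ S (v i) (v (next i)) →
                Agrees (suc k) X B
  Agrees-skip {k = k} {X = X} {i = i} agr i≡k ¬Sᵢ = record
    { symmetric = symmetric ; forest = forest ; reach = reach
    ; sound     = Sum.map₂ (map₂ earlier-suc) ∘ sound
    ; keeps-T   = keeps-T
    ; keeps-C   = λ j j<1+k Sⱼ → keeps-C′ j (<suc-split i≡k j<1+k) Sⱼ
    ; blue⊆S    = blue⊆S }
    where
    open Agrees agr
    keeps-C′ : ∀ j → toℕ j < k ⊎ j ≡ i → S (v j) (v (next j)) → X (v j) (v (next j))
    keeps-C′ j (inj₁ j<k) Sⱼ = keeps-C j j<k Sⱼ
    keeps-C′ j (inj₂ refl) Sⱼ = ⊥-elim (¬Sᵢ Sⱼ)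

  S-avoids : ∀ {c d} → ¬ S c d → S x y → ¬ SameEdge (c , d) x y
  S-avoids ¬Scd Sxy cd≅xy = ¬Scd (resp-SameEdge symS cd≅xy Sxy)

  AgreeingStep : ℕ → EdgeRel n → List (Edge n) → Fin p → Set₁
  AgreeingStep k X B i = ∃[ X′ ] ∃[ B′ ] (Step X B i X′ B′ × Agrees (suc k) X′ B′)

  module InsertCycleEdge (agr : Agrees k X B) (i : Fin p) (i≡k : toℕ i ≡ k)
                         (Sᵢ : S (v i) (v (next i))) where

    open Agrees agr

    X⁺ : Fin n → Fin n → EdgeRel n
    X⁺ c d = delE (addE X (e i)) (c , d)

    Agrees⁺ : ∀ {c d B′} → ¬ S c d → Forest (X⁺ c d) → Star (X⁺ c d) c d →
              All (uncurry′ S) B′ → Agrees (suc k) (X⁺ c d) B′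
    Agrees⁺ {c} {d} ¬Scd forest⁺ c⇝d blue⁺ = record
      { symmetric = sym⁺
      ; forest    = forest⁺
      ; reach     = λ z → reroute sym⁺ (λ r ¬cd → inj₁ r , ¬cd) c⇝d (reach z)
      ; sound     = sound⁺
      ; keeps-T   = λ s t → inj₁ (keeps-T s t) , S-avoids ¬Scd s
      ; keeps-C   = λ j j<1+k Sⱼ → keeps-C⁺ j (<suc-split i≡k j<1+k) Sⱼ
      ; blue⊆S    = blue⁺ }
      where
      sym⁺ : Symmetric (X⁺ c d)
      sym⁺ = symmetric-delE (symmetric-addE symmetric)
      sound⁺ : X⁺ c d x y → T x y ⊎ (S x y × EarlierCycleEdge (suc k) x y)
      sound⁺ (inj₁ r , _)  = Sum.map₂ (map₂ earlier-suc) (sound r)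
      sound⁺ (inj₂ eᵢ≅xy , _) =
        inj₂ ( resp-SameEdge symS (SameEdge-sym eᵢ≅xy) Sᵢ
             , i , s≤s (≤-reflexive i≡k) , eᵢ≅xy)
      keeps-C⁺ : ∀ j → toℕ j < k ⊎ j ≡ i → S (v j) (v (next j)) →
                 X⁺ c d (v j) (v (next j))
      keeps-C⁺ j (inj₁ j<k) Sⱼ = inj₁ (keeps-C j j<k Sⱼ) , S-avoids ¬Scd Sⱼ
      keeps-C⁺ j (inj₂ refl) Sⱼ = inj₂ (inj₁ (refl , refl)) , S-avoids ¬Scd Sⱼ

    ¬Xᵢ : ¬ X (v i) (v (next i))
    ¬Xᵢ = cycleEdge∉ (≤-reflexive (sym i≡k))

    Puvᵢ : Star X u (v i)
    Puvᵢ = proj₁ (loop-erase (reach (v i)))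

    Puvᵢ-unique : Unique (verts Puvᵢ)
    Puvᵢ-unique = proj₂ (loop-erase (reach (v i)))

    cycle : Fork Puvᵢ (v (next i))
    cycle = fork Puvᵢ (loop-erase (reach (v (next i))))

    -- branch is the vertex v of the paper: C* consists of left, right and e_i.
    open Fork cycle

    cycle-split : CycleSplit X i (verts left) (verts right)
    cycle-split = record
      { pre = initVerts stem ; w = branch ; ra = tailVerts left ; rb = tailVerts right
      ; pathA = subst (IsPath X u (v i)) (verts-◅◅ stem left)
                      (Unique⇒IsPath (stem ◅◅ left)
                                     (subst (Unique ∘ verts) PA-splits Puvᵢ-unique))
      ; pathB = subst (IsPath X u (v (next i))) (verts-◅◅ stem right)
                      (Unique⇒IsPath (stem ◅◅ right) (stem◅◅right-unique Puvᵢ-unique))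
      ; disj = tails-disjoint ; L-def = refl ; R-def = refl }

    S-edges-avoid : ∀ {c d} → ¬ S c d → X x y → S x y → delE X (c , d) x y
    S-edges-avoid ¬Scd xy Sxy = xy , S-avoids ¬Scd Sxy

    via-right : LastViolation S right → AgreeingStep k X B i
    via-right violation = X⁺ c d , B ++ pathEdges (verts after)
      , inR (c , d) ¬Xᵢ cycle-split ¬C ¬B (initVerts before) c d (tailVerts after)
            right-verts (inj₁ (refl , refl))
      , Agrees⁺ violates (proj₁ exchanged) (proj₂ exchanged)
                (All-++⁺ blue⊆S (AllEdges⇒pathEdges after after-P))
      where
      open LastViolation violation
      ¬C : ¬ CEdge c d
      ¬C = proj₁ (outside-S-removable edge violates)
      ¬B : (c , d) ∉E B
      ¬B = proj₂ (outside-S-removable edge violates)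
      right-verts : verts right ≡ initVerts before ++ (c ∷ d ∷ tailVerts after)
      right-verts = trans (cong verts splits) (verts-◅◅ before (edge ◅ after))
      d∉before : d ∉ verts before
      d∉before = path-target∉prefix before edge after (subst (Unique ∘ verts) splits right-unique)
      d∉left : d ∉ verts left
      d∉left = right-fresh-left
        (subst (λ W → d ∈ tailVerts W) (sym splits) (target∈tailVerts before edge after))
      exchanged : Forest (X⁺ c d) × Star (X⁺ c d) c d
      exchanged = exchange symmetric forest edge (¬C ∘ (i ,_))
        (rev (symmetric-delE symmetric) (avoiding before d∉before) ◅◅ avoiding left d∉left)
        (restrict (S-edges-avoid violates) after after-P)

    via-left : AllEdges S right → LastViolation S left → AgreeingStep k X B i
    via-left right-S violation = X⁺ c d , B ++ pathEdges (verts right)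
      , notInR (c , d) ¬Xᵢ cycle-split on-cycle ¬C ¬B ¬on-right
      , Agrees⁺ violates (proj₁ exchanged) (proj₂ exchanged) (All-++⁺ blue⊆S right-S-edges)
      where
      open LastViolation violation
      ¬C : ¬ CEdge c d
      ¬C = proj₁ (outside-S-removable edge violates)
      ¬B : (c , d) ∉E B
      ¬B = proj₂ (outside-S-removable edge violates)
      right-S-edges : All (uncurry′ S) (pathEdges (verts right))
      right-S-edges = AllEdges⇒pathEdges right right-S
      on-cycle : (c , d) ∈E (pathEdges (verts left) ++ pathEdges (verts right))
      on-cycle = inj₁ (∈-++⁺ˡ (subst (λ W → (c , d) ∈ pathEdges (verts W)) (sym splits)
                                     (∈-pathEdges before edge after)))
      ¬on-right : (c , d) ∉E pathEdges (verts right)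
      ¬on-right (inj₁ cd∈) = violates (lookup right-S-edges cd∈)
      ¬on-right (inj₂ dc∈) = violates (symS _ _ (lookup right-S-edges dc∈))
      d∉before : d ∉ verts before
      d∉before = path-target∉prefix before edge after
                   (subst (Unique ∘ verts) splits (left-unique Puvᵢ-unique))
      exchanged : Forest (X⁺ c d) × Star (X⁺ c d) c d
      exchanged = Product.map (Forest-⊆ (delE-addE-swap {R = X})) (Star.map (delE-addE-swap {R = X}))
        (exchange symmetric forest edge (¬C ∘ (i ,_) ∘ Sum.swap)
          (rev (symmetric-delE symmetric) (avoiding before d∉before)
             ◅◅ restrict (S-edges-avoid violates) right right-S)
          (restrict (S-edges-avoid violates) after after-P))

    S-bypass : AllEdges S left → AllEdges S right → ⊥
    S-bypass left-S right-S = IsTree⇒Forest S-tree _ _ Sᵢ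
      (rev (symmetric-delE symS) (restrict off-eᵢ left left-S) ◅◅ restrict off-eᵢ right right-S)
      where
      off-eᵢ : X x y → S x y → delE S (e i) x y
      off-eᵢ xy Sxy = Sxy , λ eᵢ≅xy → ¬Xᵢ (resp-SameEdge symmetric eᵢ≅xy xy)

    step : AgreeingStep k X B i
    step with last-violation S? right
    ... | inj₂ violation = via-right violation
    ... | inj₁ right-S with last-violation S? left
    ...   | inj₂ violation = via-left right-S violation
    ...   | inj₁ left-S    = ⊥-elim (S-bypass left-S right-S)

  record Stage (k : ℕ) : Set₁ where
    field
      {tree}   : EdgeRel n
      {blue}   : List (Edge n)
      output : Output tree
      calls  : ∀ j → k ≤ toℕ j → Call tree blue j
      agrees : Agrees k tree blue

  advance : k < p → Stage k → Stage (suc k)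
  advance {k} k<p st = next-stage (S? (v i) (v (next i)))
    where
    open Stage st
    i : Fin p
    i = fromℕ< k<p
    i≡k : toℕ i ≡ k
    i≡k = toℕ-fromℕ< k<p
    call : Call tree blue i
    call = calls i (≤-reflexive (sym i≡k))
    next-stage : Dec (S (v i) (v (next i))) → Stage (suc k)
    next-stage (no ¬Sᵢ) = record
      { output = output
      ; calls  = λ j k<j → calls j (<⇒≤ k<j)
      ; agrees = Agrees-skip agrees i≡k ¬Sᵢ }
    next-stage (yes Sᵢ) with InsertCycleEdge.step agrees i i≡k Sᵢ
    ... | _ , _ , step , agrees′ = record
      { output = out-step call step
      ; calls  = λ j k<j → recur call step j (subst (_< toℕ j) (sym i≡k) k<j)
      ; agrees = agrees′ }

  stage : ∀ k → k ≤ p → Stage k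
  stage zero    _     = record { output = out-T ; calls = λ j _ → start j ; agrees = Agrees-T }
  stage (suc k) k<p = advance k<p (stage k (<⇒≤ k<p))

  Agrees⇒≐ : Agrees p X B → X ≐ S
  Agrees⇒≐ {X = X} agr = tree⊆forest⇒≐ S-tree forest S⊆X
    where
    open Agrees agr
    S⊆X : S x y → X x y
    S⊆X s with proj₁ S-spanning _ _ s
    ... | inj₁ t                         = keeps-T s t
    ... | inj₂ (j , inj₁ (refl , refl)) = keeps-C j (toℕ<n j) s
    ... | inj₂ (j , inj₂ (refl , refl)) = symmetric _ _ (keeps-C j (toℕ<n j) (symS _ _ s))

theorem5 : (n : ℕ) (H : Halin n) (u : Fin n) (S : EdgeRel n) →
    Halin.SpanningTree H S →
    ∃[ X ] (Procedure.Output H u X × X ≐ S)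
theorem5 n H u S S-spanning = _ , output , Agrees⇒≐ agrees
  where
  open Completeness H u S-spanning
  open Stage (stage (Halin.p H) ≤-refl)
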